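{- Let $T$ be a tableau and $x,y$ distinct elements not among the labels of $T$. Suppose the column trail of $x\to T$ and the row trail of $T\leftarrow y$ have a common box $S$ which is a box of $T$; let $s$ be its label, $c$ its column and $\ell$ its row. Let $B$ (resp. $J$) be the box following $S$ in the column trail (resp. row trail); it may be the empty box of that trail. Let $A$ (resp. $I$) be the box preceding $S$ in the column trail (resp. row trail), when it exists. Then none of the following three configurations occurs: (1) $A$ exists, $A$ lies in a row strictly above row $\ell$, and $J$ lies in a column $\le c-1$; (2) $A$ exists and is the box $(c-1,\ell)$, and $I$ exists and is the box $(c,\ell-1)$; (3) $I$ exists, $I$ lies in a column $\ge c+1$, and $B$ lies in a row $\le \ell-1$.
   Context: Tableaux use the French convention: a tableau $T$ is a finite lower order ideal $D$ (componentwise order) of boxes $(c,r)\in\{1,2,\dots\}^2$ ($c$ = column, $r$ = row, row $1$ at the bottom, "above" = larger row index), with an injective labelling by a totally ordered set, strictly increasing to the right along rows and upward along columns. Row insertion of $x$ into a row $L$ ($x\notin L$): if $L$ is empty or $x>\max L$, append $x$; otherwise replace the smallest $z\in L$ with $z>x$ by $x$, and $z$ is bumped. $T\leftarrow x$ inserts $x$ into row $1$, then the bumped element into row $2$, etc., until nothing is bumped (the last element occupies a new box at the end of its row). Column insertion $x\to T$ is defined symmetrically with columns (column $1$ leftmost). The row trail of $T\leftarrow x$ is the sequence of boxes of $T$ whose labels are bumped, in order (with their labels in $T$), followed by the newly created box (the empty box of the trail, not in $T$). The column trail of $x\to T$ is defined symmetrically. -}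

module Defs where

open import Data.Nat using (ℕ; zero; suc; _+_; _≤_; _<_)
open import Data.Product using (_×_; _,_; proj₁; proj₂; Σ; ∃)
open import Data.Maybe using (Maybe; just; nothing)
open import Data.List using (List; []; _∷_; [_]; _++_; length; map; mapMaybe; upTo; concat)
open import Data.List.Relation.Unary.All using (All)
open import Data.List.Relation.Unary.Linked using (Linked)
open import Data.List.Relation.Unary.Unique.Propositional using (Unique)
open import Data.Unit using (⊤)
open import Data.Empty using (⊥)
open import Relation.Binary.PropositionalEquality using (_≡_)
open import Relation.Binary.Structures using (IsStrictTotalOrder)
open import Relation.Binary.Definitions using (tri<; tri≈; tri>)

-- Boxes (c , r) : c = column, r = row, both 1-based; row 1 at the bottom.
Box : Set
Box = ℕ × ℕ

col : Box → ℕ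
col = proj₁

row : Box → ℕ
row = proj₂

module Tab {A : Set} (_≺_ : A → A → Set) (sto : IsStrictTotalOrder _≡_ _≺_) where

  open IsStrictTotalOrder sto using (compare)

  nth : ℕ → List A → Maybe A
  nth _       []       = nothing
  nth zero    (a ∷ _)  = just a
  nth (suc n) (_ ∷ as) = nth n as

  -- the row above is dominated entrywise by the row below
  -- (encodes: shorter-or-equal length and strict increase up columns)
  ColStrict : List A → List A → Set
  ColStrict _        []       = ⊤
  ColStrict []       (_ ∷ _)  = ⊥
  ColStrict (a ∷ as) (b ∷ bs) = (a ≺ b) × ColStrict as bs

  -- A tableau (French convention), given by its list of rows, row 1 first.
  record Tableau : Set where
    field
      rows      : List (List A)
      nonempty  : All (λ R → 0 < length R) rows
      shape     : Linked (λ R R' → length R' ≤ length R) rows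
      rowIncr   : All (Linked _≺_) rows
      colIncr   : Linked ColStrict rows
      injective : Unique (concat rows)
  open Tableau public

  labels : Tableau → List A
  labels T = concat (rows T)

  -- columns of a list of rows (column 1 first, each listed bottom to top)
  columns : List (List A) → List (List A)
  columns []       = []
  columns (R ∷ Rs) = map (λ c → mapMaybe (nth c) (R ∷ Rs)) (upTo (length R))

  -- insertion of x into one line: new line, and possibly (1-based position, bumped label)
  insertLine : A → List A → List A × Maybe (ℕ × A)
  insertLine x [] = (x ∷ [] , nothing)
  insertLine x (z ∷ zs) with compare x z
  ... | tri< _ _ _ = (x ∷ zs , just (1 , z))
  ... | tri≈ _ _ _ = (z ∷ zs , nothing)      -- never used: x is not in the line
  ... | tri> _ _ _ with insertLine x zs
  ...   | (zs' , nothing)      = (z ∷ zs' , nothing)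
  ...   | (zs' , just (p , w)) = (z ∷ zs' , just (suc p , w))

  -- Returns the trail as pairs (line index, 1-based position in the line):
  -- the bumped positions, followed by the newly created position.
  lineTrail : A → ℕ → List (List A) → List (ℕ × ℕ)
  lineTrail x k [] = (k , 1) ∷ []
  lineTrail x k (L ∷ Ls) with insertLine x L
  ... | (_ , nothing)      = (k , suc (length L)) ∷ []
  ... | (_ , just (p , z)) = (k , p) ∷ lineTrail z (suc k) Ls

  -- Row trail of T ← y (boxes as (column, row)); the last box is the empty box.
  rowTrail : Tableau → A → List Box
  rowTrail T y = map (λ kp → (proj₂ kp , proj₁ kp)) (lineTrail y 1 (rows T))

  -- Column trail of x → T (boxes as (column, row)); the last box is the empty box.
  colTrail : A → Tableau → List Box
  colTrail x T = lineTrail x 1 (columns (rows T))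

-- If a sits in the box A preceding S in the column trail, then a bumps the label s of S,
-- so a ≺ s and every label below S in its column is ≺ a; the same holds for the
-- predecessor I in the row trail.  Labels increase weakly up and to the right, so in (1)
-- the box J lies weakly south-west of A and holds a label ≼ a ≺ s, although s, moving
-- into J, must be smaller than whatever J holds; (3) is the transpose of (1).  In (2),
-- I lies below S in its column and A left of S in its row, whence i ≺ a and a ≺ i.
module Submission where

open import Defs
open import Data.Nat using (ℕ; zero; suc; _≤_; _<_; _≤′_; ≤′-refl; ≤′-step; _∸_; _+_; z≤n; s≤s)
open import Data.Nat.Properties
  using (≤-refl; ≤-trans; ≮⇒≥; _<?_; ≤⇒≤′; ∸-monoˡ-≤; +-comm; +-suc; +-identityʳ; +-cancelˡ-≡)
open import Data.Product using (_×_; _,_; ∃; ∃₂; swap)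
open import Data.Maybe using (Maybe; just; nothing)
open import Data.Maybe.Properties using (just-injective)
open import Data.List using (List; []; _∷_; [_]; _++_; length; map; mapMaybe; applyUpTo)
open import Data.List.Properties using (++-assoc; map-++; map-∘; map-id; map-upTo; ∷-injective)
open import Data.List.Relation.Unary.All using (All; _∷_)
open import Data.List.Relation.Unary.Linked using (Linked; []; [-]; _∷_)
import Data.List.Relation.Unary.Linked as Linked
open import Data.List.Membership.Propositional using (_∉_)
open import Data.Empty using (⊥; ⊥-elim)
open import Function using (_∘_)
open import Relation.Nullary using (¬_; yes; no)
open import Relation.Binary.PropositionalEquality
  using (_≡_; _≢_; refl; sym; trans; cong; subst; module ≡-Reasoning)
open import Relation.Binary.Structures using (IsStrictTotalOrder)
open import Relation.Binary.Definitions using (tri<; tri≈; tri>)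
import Relation.Binary.Construct.StrictToNonStrict as NonStrict

prefix-snoc : ∀ {X : Set} {l pre rest p : List X} {a : X} →
  pre ≡ p ++ [ a ] → l ≡ pre ++ rest → l ≡ p ++ a ∷ rest
prefix-snoc {rest = rest} {p} {a} refl l≡ = trans l≡ (++-assoc p [ a ] rest)

map-swap-inverse : ∀ {X Y : Set} {xs : List (X × Y)} {ys} → map swap xs ≡ ys → xs ≡ map swap ys
map-swap-inverse {xs = xs} refl = trans (sym (map-id xs)) (map-∘ xs)

singleton≢++∷∷ : ∀ {X : Set} (pre : List X) {a b c post} → a ∷ [] ≢ pre ++ b ∷ c ∷ post
singleton≢++∷∷ []            ()
singleton≢++∷∷ (_ ∷ [])      ()
singleton≢++∷∷ (_ ∷ _ ∷ _)   ()

module _ {A : Set} (_≺_ : A → A → Set) (sto : IsStrictTotalOrder _≡_ _≺_) where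

  open Tab _≺_ sto
  open IsStrictTotalOrder sto using (compare; irrefl; asym; isEquivalence; <-resp-≈; <-respˡ-≈)
    renaming (trans to ≺-trans)
  open NonStrict _≡_ _≺_ using (<⇒≤; reflexive) renaming (_≤_ to _≼_)
  open ≡-Reasoning

  ≼-trans : ∀ {a b c} → a ≼ b → b ≼ c → a ≼ c
  ≼-trans = NonStrict.trans _≡_ _≺_ isEquivalence <-resp-≈ ≺-trans

  ≼-≺-trans : ∀ {a b c} → a ≼ b → b ≺ c → a ≺ c
  ≼-≺-trans = NonStrict.≤-<-trans _≡_ _≺_ sym ≺-trans <-respˡ-≈

  ≺-≺-≼-cycle : ∀ {a b c} → a ≺ b → b ≺ c → ¬ (c ≼ a)
  ≺-≺-≼-cycle a≺b b≺c c≼a = irrefl refl (≼-≺-trans c≼a (≺-trans a≺b b≺c))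

  line : ℕ → List (List A) → List A
  line _       []       = []
  line zero    (L ∷ _)  = L
  line (suc i) (_ ∷ Ls) = line i Ls

  -- Indices are 0-based here, whereas the boxes of a trail are 1-based.
  entry : List (List A) → ℕ → ℕ → Maybe A
  entry Ls c r = nth c (line r Ls)

  nth-≥length : ∀ (L : List A) {i} → length L ≤ i → nth i L ≡ nothing
  nth-≥length []      _         = refl
  nth-≥length (_ ∷ L) (s≤s le) = nth-≥length L le

  nth-nothing⇒≥length : ∀ (L : List A) i → nth i L ≡ nothing → length L ≤ i
  nth-nothing⇒≥length []      _       _  = z≤n
  nth-nothing⇒≥length (_ ∷ L) (suc i) eq = s≤s (nth-nothing⇒≥length L i eq)

  Bumps : A → List A → ℕ → A → Set
  Bumps u L j t = nth j L ≡ just t × u ≺ t × (∀ i {w} → i < j → nth i L ≡ just w → w ≺ u)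

  -- p is 1-based, as in trails; an empty position (the end of a trail) imposes nothing.
  Lands : A → List A → ℕ → Set
  Lands u L p = ∀ {t} → nth (p ∸ 1) L ≡ just t → Bumps u L (p ∸ 1) t

  bumps⇒lands : ∀ {u L j t} → Bumps u L j t → Lands u L (suc j)
  bumps⇒lands {u} {L} {j} bumps@(at≡t , _) at≡t′ =
    subst (Bumps u L j) (just-injective (trans (sym at≡t) at≡t′)) bumps

  insertLine-bumps : ∀ v L {L′ p z} → insertLine v L ≡ (L′ , just (p , z)) → ∃ λ j → p ≡ suc j × Bumps v L j z
  insertLine-bumps v (z ∷ zs) eq with compare v z
  insertLine-bumps v (z ∷ zs) refl | tri< v≺z _ _ = 0 , refl , refl , v≺z , λ _ ()
  insertLine-bumps v (z ∷ zs) ()   | tri≈ _ _ _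
  insertLine-bumps v (z ∷ zs) eq   | tri> _ _ z≺v with insertLine v zs in eq′
  insertLine-bumps v (z ∷ zs) ()   | tri> _ _ z≺v | (_ , nothing)
  insertLine-bumps v (z ∷ zs) refl | tri> _ _ z≺v | (_ , just _) with insertLine-bumps v zs eq′
  ... | j , refl , at≡w , v≺w , before = suc j , refl , at≡w , v≺w , before′
    where
    before′ : ∀ i {w} → i < suc j → nth i (z ∷ zs) ≡ just w → w ≺ v
    before′ zero    _         refl = z≺v
    before′ (suc i) (s≤s i<j) at≡w′ = before i i<j at≡w′

  lineTrail-head : ∀ v k Ls {i p rest} → lineTrail v k Ls ≡ (i , p) ∷ rest → i ≡ k × Lands v (line 0 Ls) p
  lineTrail-head v k []       refl = refl , λ ()
  lineTrail-head v k (L ∷ Ls) eq with insertLine v L in ins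
  lineTrail-head v k (L ∷ Ls) refl | (_ , nothing) =
    refl , lands-past-end
    where
    lands-past-end : Lands v L (suc (length L))
    lands-past-end at≡t with trans (sym at≡t) (nth-≥length L ≤-refl)
    ... | ()
  lineTrail-head v k (L ∷ Ls) refl | (_ , just _) with insertLine-bumps v L ins
  ... | _ , refl , bumps = refl , bumps⇒lands {L = L} bumps

  lineTrail-step : ∀ v k Ls pre {i p i′ p′ post} →
    lineTrail v k Ls ≡ pre ++ (i , p) ∷ (i′ , p′) ∷ post →
    ∃ λ d → i ≡ k + d × i′ ≡ k + suc d × ∃ λ s → entry Ls (p ∸ 1) d ≡ just s × Lands s (line (suc d) Ls) p′
  lineTrail-step v k [] pre eq = ⊥-elim (singleton≢++∷∷ pre eq)
  lineTrail-step v k (L ∷ Ls) pre eq with insertLine v L in ins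
  lineTrail-step v k (L ∷ Ls) pre eq | (_ , nothing) = ⊥-elim (singleton≢++∷∷ pre eq)
  lineTrail-step v k (L ∷ Ls) [] eq | (_ , just _) with ∷-injective eq | insertLine-bumps v L ins
  ... | refl , tail | _ , refl , at≡z , _ with lineTrail-head _ (suc k) Ls tail
  ...   | i′≡ , lands = 0 , sym (+-identityʳ k) , trans i′≡ (+-comm 1 k) , _ , at≡z , lands
  lineTrail-step v k (L ∷ Ls) (_ ∷ pre) eq | (_ , just _) with ∷-injective eq
  ... | refl , tail with lineTrail-step _ (suc k) Ls pre tail
  ...   | d , i≡ , i′≡ , s , at≡s , lands =
    suc d , trans i≡ (sym (+-suc k d)) , trans i′≡ (sym (+-suc k (suc d))) , s , at≡s , lands

  lineTrail-bump : ∀ v k Ls pre {i p i′ p′ E post} →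
    lineTrail v k Ls ≡ pre ++ (i , p) ∷ (i′ , p′) ∷ E ∷ post →
    ∃ λ d → i ≡ k + d × i′ ≡ k + suc d ×
      ∃₂ λ a s → entry Ls (p ∸ 1) d ≡ just a × Bumps a (line (suc d) Ls) (p′ ∸ 1) s
  lineTrail-bump v k Ls pre {i} {p} eq
    with lineTrail-step v k Ls pre eq
       | lineTrail-step v k Ls (pre ++ [ (i , p) ]) (trans eq (sym (++-assoc pre _ _)))
  ... | d , i≡ , i′≡ , a , at≡a , lands | d′ , i′≡′ , _ , s , at≡s , _
    with +-cancelˡ-≡ k d′ (suc d) (trans (sym i′≡′) i′≡)
  ... | refl = d , i≡ , i′≡ , a , s , at≡a , lands at≡s

  LengthsDecreasing : List (List A) → Set
  LengthsDecreasing = Linked (λ R R′ → length R′ ≤ length R)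

  entry-outside-shape : ∀ {R rs i} → LengthsDecreasing (R ∷ rs) → length R ≤ i → ∀ j → entry (R ∷ rs) i j ≡ nothing
  entry-outside-shape {R} _  le zero    = nth-≥length R le
  entry-outside-shape     [-] _ (suc j) = refl
  entry-outside-shape (R≥R′ ∷ decr) le (suc j) = entry-outside-shape decr (≤-trans R≥R′ le) j

  nth-column : ∀ rs → LengthsDecreasing rs → ∀ i j → nth j (mapMaybe (nth i) rs) ≡ entry rs i j
  nth-column [] _ i j = refl
  nth-column (R ∷ rs) decr i j with nth i R in at
  nth-column (R ∷ rs) decr i zero    | just _ = sym at
  nth-column (R ∷ rs) decr i (suc j) | just _ = nth-column rs (Linked.tail decr) i j
  nth-column (R ∷ rs) decr i j       | nothing = begin
    nth j (mapMaybe (nth i) rs) ≡⟨ nth-column rs (Linked.tail decr) i j ⟩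
    entry rs i j                ≡⟨ entry-outside-shape decr short (suc j) ⟩
    nothing                     ≡⟨ sym (entry-outside-shape decr short j) ⟩
    entry (R ∷ rs) i j          ∎
    where
    short : length R ≤ i
    short = nth-nothing⇒≥length R i at

  line-applyUpTo : ∀ (f : ℕ → List A) {n i} → i < n → line i (applyUpTo f n) ≡ f i
  line-applyUpTo f {i = zero}  (s≤s _)   = refl
  line-applyUpTo f {i = suc i} (s≤s i<n) = line-applyUpTo (f ∘ suc) i<n

  line-applyUpTo-≥ : ∀ (f : ℕ → List A) {n i} → n ≤ i → line i (applyUpTo f n) ≡ []
  line-applyUpTo-≥ f z≤n       = refl
  line-applyUpTo-≥ f (s≤s n≤i) = line-applyUpTo-≥ (f ∘ suc) n≤i

  Transposed : List (List A) → List (List A) → Set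
  Transposed Ls Ms = ∀ i j → entry Ls j i ≡ entry Ms i j

  transposed-sym : ∀ Ls Ms → Transposed Ls Ms → Transposed Ms Ls
  transposed-sym _ _ Lsᵀ i j = sym (Lsᵀ j i)

  columns-transposed : ∀ rs → LengthsDecreasing rs → Transposed (columns rs) rs
  columns-transposed []       _    i j = refl
  columns-transposed (R ∷ rs) decr i j
    rewrite map-upTo (λ c → mapMaybe (nth c) (R ∷ rs)) (length R) with i <? length R
  ... | yes i<R = trans (cong (nth j) (line-applyUpTo _ i<R)) (nth-column (R ∷ rs) decr i j)
  ... | no  i≮R = trans (cong (nth j) (line-applyUpTo-≥ _ (≮⇒≥ i≮R))) (sym (entry-outside-shape decr (≮⇒≥ i≮R) j))

  Increasing : (ℕ → Maybe A) → Set
  Increasing f = ∀ n {b} → f (suc n) ≡ just b → ∃ λ a → f n ≡ just a × a ≺ b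

  increasing-mono : ∀ {f m n b} → Increasing f → f n ≡ just b → m ≤′ n → ∃ λ a → f m ≡ just a × a ≼ b
  increasing-mono inc fn≡b ≤′-refl = _ , fn≡b , reflexive refl
  increasing-mono {n = suc n} inc fn≡b (≤′-step m≤′n) with inc n fn≡b
  ... | c , fn≡c , c≺b with increasing-mono inc fn≡c m≤′n
  ...   | a , fm≡a , a≼c = a , fm≡a , <⇒≤ (≼-≺-trans a≼c c≺b)

  row-increasing : ∀ {L} → Linked _≺_ L → Increasing (λ i → nth i L)
  row-increasing (z≺w ∷ _)  zero    refl  = _ , refl , z≺w
  row-increasing (_ ∷ incr) (suc i) at≡b  = row-increasing incr i at≡b
  row-increasing [-]        _       ()

  colStrict-below : ∀ R R′ → ColStrict R R′ → ∀ i {b} → nth i R′ ≡ just b → ∃ λ a → nth i R ≡ just a × a ≺ b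
  colStrict-below (a ∷ _) (_ ∷ _)  (a≺b , _) zero    refl = a , refl , a≺b
  colStrict-below (_ ∷ R) (_ ∷ R′) (_ , cs)  (suc i) at≡b = colStrict-below R R′ cs i at≡b

  column-increasing : ∀ {rs} → Linked ColStrict rs → ∀ i → Increasing (entry rs i)
  column-increasing (cs ∷ _)   i zero    at≡b = colStrict-below _ _ cs i at≡b
  column-increasing (_ ∷ incr) i (suc j) at≡b = column-increasing incr i j at≡b
  column-increasing [-]        i _       ()

  All-line : ∀ {P : List A → Set} {rs} → All P rs → P [] → ∀ j → P (line j rs)
  All-line {rs = []}     _          p[] _       = p[]
  All-line {rs = _ ∷ _}  (pR ∷ _)   _   zero    = pR
  All-line {rs = _ ∷ _}  (_ ∷ prs)  p[] (suc j) = All-line prs p[] j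

  Monotone : List (List A) → Set
  Monotone Ls = ∀ {c r c′ r′ b} → entry Ls c r ≡ just b → c′ ≤ c → r′ ≤ r →
    ∃ λ a → entry Ls c′ r′ ≡ just a × a ≼ b

  tableau-monotone : ∀ T → Monotone (rows T)
  tableau-monotone T at≡b c′≤c r′≤r
    with increasing-mono (column-increasing (colIncr T) _) at≡b (≤⇒≤′ r′≤r)
  ... | b′ , at≡b′ , b′≼b with increasing-mono (row-increasing (All-line (rowIncr T) [] _)) at≡b′ (≤⇒≤′ c′≤c)
  ...   | a , at≡a , a≼b′ = a , at≡a , ≼-trans a≼b′ b′≼b

  monotone-transposed : ∀ Ls Ms → Transposed Ls Ms → Monotone Ms → Monotone Ls
  monotone-transposed _ _ Lsᵀ mono {c} {r} {c′} {r′} at≡b c′≤c r′≤r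
    with mono (trans (sym (Lsᵀ r c)) at≡b) r′≤r c′≤c
  ... | a , at≡a , a≼b = a , trans (Lsᵀ r′ c′) at≡a , a≼b

  lands-southwest-absurd : ∀ Ls Ms x y {p q ai ap si sp E ji jp post post′} →
    Transposed Ls Ms → Monotone Ms →
    lineTrail x 1 Ls ≡ p ++ (ai , ap) ∷ (si , sp) ∷ E ∷ post →
    lineTrail y 1 Ms ≡ q ++ (sp , si) ∷ (ji , jp) ∷ post′ →
    sp < ap → jp ≤ si ∸ 1 → ⊥
  lands-southwest-absurd Ls Ms x y {p} {q} {ap = ap} Lsᵀ mono trailₗ trailₘ sp<ap jp≤si
    with lineTrail-bump x 1 Ls p trailₗ | lineTrail-step y 1 Ms q trailₘ
  ... | dA , refl , refl , a , s , at≡a , (at≡s , a≺s , _) | dS , refl , _ , s′ , at≡s′ , lands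
    with trans (sym at≡s′) (trans (sym (Lsᵀ (suc dA) dS)) at≡s)
  ... | refl with mono (trans (sym (Lsᵀ dA (ap ∸ 1))) at≡a) (∸-monoˡ-≤ 1 jp≤si) (∸-monoˡ-≤ 1 sp<ap)
  ...   | t , at≡t , t≼a with lands at≡t
  ...     | _ , s≺t , _ = ≺-≺-≼-cycle a≺s s≺t t≼a

  mutual-bump-absurd : ∀ Ls Ms x y {p q si sp E E′ post post′} → Transposed Ls Ms →
    lineTrail x 1 Ls ≡ p ++ (si ∸ 1 , sp) ∷ (si , sp) ∷ E ∷ post →
    lineTrail y 1 Ms ≡ q ++ (sp ∸ 1 , si) ∷ (sp , si) ∷ E′ ∷ post′ → ⊥
  mutual-bump-absurd Ls Ms x y {p} {q} Lsᵀ trailₗ trailₘ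
    with lineTrail-bump x 1 Ls p trailₗ | lineTrail-bump y 1 Ms q trailₘ
  ... | dA , _ , refl , a , _ , at≡a , (_ , _ , below-a) | dI , _ , refl , i , _ , at≡i , (_ , _ , below-i) =
    asym (below-a dI ≤-refl (trans (Lsᵀ (suc dA) dI) at≡i))
         (below-i dA ≤-refl (trans (sym (Lsᵀ dA (suc dI))) at≡a))

  rowTrail-lines : ∀ T y pre post → rowTrail T y ≡ pre ++ post →
    lineTrail y 1 (rows T) ≡ map swap pre ++ map swap post
  rowTrail-lines T y pre post trail = trans (map-swap-inverse trail) (map-++ swap pre post)

lemma6 : {A : Set} (_≺_ : A → A → Set) (sto : IsStrictTotalOrder _≡_ _≺_)
    (T : Tab.Tableau _≺_ sto) (x y : A) →
    x ≢ y → x ∉ Tab.labels _≺_ sto T → y ∉ Tab.labels _≺_ sto T →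
    (S B J : Box) (preC postC preR postR : List Box) →
    Tab.colTrail _≺_ sto x T ≡ preC ++ S ∷ B ∷ postC →
    Tab.rowTrail _≺_ sto T y ≡ preR ++ S ∷ J ∷ postR →
    (¬ (∃ λ A' → ∃ λ p → preC ≡ p ++ [ A' ] × row S < row A' × col J ≤ col S ∸ 1))
    × (¬ (∃ λ A' → ∃ λ p → ∃ λ I → ∃ λ q → preC ≡ p ++ [ A' ] × preR ≡ q ++ [ I ]
           × A' ≡ (col S ∸ 1 , row S) × I ≡ (col S , row S ∸ 1)))
    × (¬ (∃ λ I → ∃ λ q → preR ≡ q ++ [ I ] × col S + 1 ≤ col I × row B ≤ row S ∸ 1))
lemma6 _≺_ sto T x y _ _ _ S B J preC postC preR postR colTrail rowTrail =
    (λ { (_ , _ , preC≡ , S<A , J≤S) →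
         lands-southwest-absurd _≺_ sto cols rs x y colsᵀ (tableau-monotone _≺_ sto T)
           (prefix-snoc preC≡ colTrail) (rowTrail-lines _≺_ sto T y preR _ rowTrail) S<A J≤S })
  , (λ { (_ , _ , _ , _ , preC≡ , preR≡ , refl , refl) →
         mutual-bump-absurd _≺_ sto cols rs x y colsᵀ (prefix-snoc preC≡ colTrail) (rowLines-via preR≡) })
  , (λ { (I , _ , preR≡ , S+1≤I , B≤S) →
         lands-southwest-absurd _≺_ sto rs cols y x (transposed-sym _≺_ sto cols rs colsᵀ)
           (monotone-transposed _≺_ sto cols rs colsᵀ (tableau-monotone _≺_ sto T))
           (rowLines-via preR≡) colTrail (subst (_≤ col I) (+-comm (col S) 1) S+1≤I) B≤S })
  where
  rs cols : List (List _)
  rs = Tab.rows T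
  cols = Tab.columns _≺_ sto rs
  colsᵀ : Transposed _≺_ sto cols rs
  colsᵀ = columns-transposed _≺_ sto rs (Tab.shape T)
  rowLines-via : ∀ {q I} → preR ≡ q ++ [ I ] →
    Tab.lineTrail _≺_ sto y 1 rs ≡ map swap q ++ swap I ∷ swap S ∷ swap J ∷ map swap postR
  rowLines-via {q} preR≡ = rowTrail-lines _≺_ sto T y q _ (prefix-snoc preR≡ rowTrail)
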